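{- Let $d\ge0$ be an integer and $S\subseteq[n]$, and let $Z_{d(S)}$ be the $\mathcal{P}_d(n)\times\mathcal{P}_d(n)$ matrix with $[Z_{d(S)}]_{I,J}=1$ if $I\subseteq J\oplus S$ and $0$ otherwise. Then $Z_{d(S)}$ is invertible and for all $I,J\in\mathcal{P}_d(n)$, $$[Z_{d(S)}^{ -1}]_{I,J}=(-1)^{|J\cap S|+|J\setminus I|}\cdot\begin{cases}(-1)^{d-|I\cup J|}\binom{|S\setminus(I\cup J)|-1}{d-|I\cup J|}, & \text{if } I\setminus S\subseteq J,\\ 0,&\text{otherwise.}\end{cases}$$
   Context: $\mathcal{P}_d(n)$ is the family of subsets of $[n]$ of size at most $d$; $\oplus$ denotes symmetric difference. Binomial coefficients are generalized: $\binom{a}{b}=0$ for $b<0$, and for integers $b\ge0$, $\binom{a}{b}=a(a-1)\cdots(a-b+1)/b!$ (so e.g. $\binom{ -1}{0}=1$). -}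

module Defs where

open import Data.Bool using (Bool; true; false; _xor_; if_then_else_)
open import Data.Nat as ℕ using (ℕ; zero; suc; _!; _≤?_)
open import Data.Nat.Properties using (_!≢0)
open import Data.Integer as ℤ using (ℤ; +_; -[1+_]; _*_; _-_; -_; _/ℕ_; 0ℤ; 1ℤ)
open import Data.List using (List; []; _∷_; _++_; map; filter; foldr)
open import Data.Vec using (Vec; []; _∷_; zipWith)
open import Data.Fin.Subset using (Subset; inside; outside; _∪_; _∩_; _─_)
open import Data.Fin.Subset.Properties using (_⊆?_)
open import Relation.Nullary.Decidable using (does)

_⊕_ : ∀ {n} → Subset n → Subset n → Subset n
_⊕_ = zipWith _xor_

allSubsets : ∀ n → List (Subset n)
allSubsets zero = [] ∷ []
allSubsets (suc n) = map (inside ∷_) (allSubsets n) ++ map (outside ∷_) (allSubsets n)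

Pd : ℕ → (n : ℕ) → List (Subset n)
Pd d n = filter (λ K → Data.Fin.Subset.∣ K ∣ ≤? d) (allSubsets n)

Mat : ℕ → Set
Mat n = Subset n → Subset n → ℤ

sumZ : List ℤ → ℤ
sumZ = foldr ℤ._+_ 0ℤ

mulPd : ∀ (d : ℕ) {n} → Mat n → Mat n → Mat n
mulPd d {n} A B I J = sumZ (map (λ K → A I K * B K J) (Pd d n))

idMat : ∀ {n} → Mat n
idMat I J = if does (I ⊆? J) ∧' does (J ⊆? I) then 1ℤ else 0ℤ
  where
  _∧'_ : Bool → Bool → Bool
  true ∧' b = b
  false ∧' b = false

negOnePow : ℤ → ℤ
negOnePow k = (ℤ.- 1ℤ) ℤ.^ ℤ.∣ k ∣

falling : ℤ → ℕ → ℤ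
falling a zero = 1ℤ
falling a (suc b) = falling a b * (a - + b)

gbinom : ℤ → ℤ → ℤ
gbinom a (+ b) = _/ℕ_ (falling a b) (b !) {{b !≢0}}
gbinom a -[1+ b ] = 0ℤ

Zmat : ∀ {n} → Subset n → Mat n
Zmat S I J = if does (I ⊆? (J ⊕ S)) then 1ℤ else 0ℤ

Wmat : ∀ (d : ℕ) {n} → Subset n → Mat n
Wmat d S I J =
  negOnePow (+ (Data.Fin.Subset.∣ J ∩ S ∣ ℕ.+ Data.Fin.Subset.∣ J ─ I ∣))
  * (if does ((I ─ S) ⊆? J)
     then negOnePow e * gbinom (+ Data.Fin.Subset.∣ S ─ (I ∪ J) ∣ - 1ℤ) e
     else 0ℤ)
  where
  e : ℤ
  e = + d - + Data.Fin.Subset.∣ I ∪ J ∣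

-- Replace the degree bound d in W by a free index D.  A summand [Z]_{I,K} [W]_{K,J} is then a sign
-- times the coefficient of x^D in x^|K ∪ J| (1 − x)^(|S ∖ (K ∪ J)| − 1), and it vanishes when |K| > D,
-- so the sum over K ∈ P_D(n) may be taken over all K ⊆ [n].  That sum factors over the coordinates:
-- each coordinate multiplies the series by 1, 0, x or 1 − x according to its bits in I, J and S, and
-- the empty ground set contributes 1 / (1 − x).  Hence from index |I| on all coefficients equal
-- [I = J], which at D = d ≥ |I| is the claim; W Z is handled in the same way with |J| in place of |I|.
module Submission where

open import Defs
open import Data.Nat using (ℕ; _≤_)
open import Data.Product using (_×_)
open import Data.Fin.Subset using (Subset; ∣_∣)
open import Relation.Binary.PropositionalEquality using (_≡_)

open import Data.Bool using (Bool; true; false; not; _∧_; _∨_; _xor_; if_then_else_)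
open import Data.Fin.Subset using (_∪_; _∩_; _─_)
open import Data.Fin.Subset.Properties using (_⊆?_; ∣p∣≤∣p∪q∣; ∣q∣≤∣p∪q∣)
open import Data.Integer as ℤ using (ℤ; +_; -[1+_]; _+_; _-_; -_; _*_; _^_; _/ℕ_; 0ℤ; 1ℤ)
import Data.Integer.Properties as ℤP
open import Data.Integer.Tactic.RingSolver using (solve-∀)
open import Data.List using (List; []; _∷_; _++_; map; filter)
import Data.List.Properties as List
open import Data.Nat as ℕ using (zero; suc; _!; _<_; _≤?_)
import Data.Nat.DivMod as ℕ
import Data.Nat.Properties as ℕP
open import Algebra.Properties.CommutativeSemigroup ℕP.+-commutativeSemigroup
  using () renaming (interchange to +-interchange)
open import Data.Product using (_,_)
open import Data.Sign using (Sign)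
open import Data.Vec using ([]; _∷_)
open import Relation.Binary.PropositionalEquality using (refl; sym; trans; cong; cong₂; subst; module ≡-Reasoning)
open import Relation.Nullary using (¬_; yes; no)
open import Relation.Nullary.Decidable using (does)
open import Relation.Unary using (Pred; Decidable)

open ≡-Reasoning

[i*n]/ℕn≡i : ∀ i n .{{_ : ℕ.NonZero n}} → (i * + n) /ℕ n ≡ i
[i*n]/ℕn≡i (+ m) n = begin
  (+ m * + n) /ℕ n   ≡⟨ cong (_/ℕ n) (sym (ℤP.pos-* m n)) ⟩
  + (m ℕ.* n ℕ./ n)  ≡⟨ cong +_ (ℕ.m*n/n≡m m n) ⟩
  + m                ∎
[i*n]/ℕn≡i -[1+ m ] (suc n) = negative (ℕ.m*n%n≡0 (suc m) (suc n))
  where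
  negative : suc m ℕ.* suc n ℕ.% suc n ≡ 0 → -[1+ m ] * + suc n /ℕ suc n ≡ -[1+ m ]
  negative divides with suc m ℕ.* suc n ℕ.% suc n
  ... | zero = cong (λ q → - + q) (ℕ.m*n/n≡m (suc m) (suc n))

-- binomPred a b is binom (a − 1) b; for a = 0 this is binom (−1) b = (−1)^b.
binomPred : ℕ → ℕ → ℤ
binomPred zero    b       = (- 1ℤ) ^ b
binomPred (suc a) zero    = 1ℤ
binomPred (suc a) (suc b) = binomPred a (suc b) + binomPred a b

falling-+1 : ∀ x b → falling (x + 1ℤ) (suc b) ≡ falling x (suc b) + + suc b * falling x b
falling-+1 x zero = ring x
  where
  ring : ∀ x → 1ℤ * (x + 1ℤ - + 0) ≡ 1ℤ * (x - + 0) + + 1 * 1ℤ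
  ring = solve-∀
falling-+1 x (suc b) = begin
  falling (x + 1ℤ) (suc b) * (x + 1ℤ - + suc b)
    ≡⟨ cong (_* (x + 1ℤ - + suc b)) (falling-+1 x b) ⟩
  (falling x (suc b) + + suc b * falling x b) * (x + 1ℤ - + suc b)
    ≡⟨ ring (falling x b) x (+ b) ⟩
  falling x (suc b) * (x - + suc b) + + suc (suc b) * falling x (suc b) ∎
  where
  ring : ∀ F x B → (F * (x - B) + (1ℤ + B) * F) * (x + 1ℤ - (1ℤ + B))
                 ≡ F * (x - B) * (x - (1ℤ + B)) + (1ℤ + (1ℤ + B)) * (F * (x - B))
  ring = solve-∀

falling-−1 : ∀ b → falling (- 1ℤ) b ≡ + (b !) * (- 1ℤ) ^ b
falling-−1 zero    = refl
falling-−1 (suc b) = begin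
  falling (- 1ℤ) b * (- 1ℤ - + b)  ≡⟨ cong (_* (- 1ℤ - + b)) (falling-−1 b) ⟩
  + (b !) * (- 1ℤ) ^ b * (- 1ℤ - + b)  ≡⟨ ring (+ (b !)) ((- 1ℤ) ^ b) (+ b) ⟩
  + suc b * + (b !) * (- 1ℤ * (- 1ℤ) ^ b)  ≡⟨ cong (_* (- 1ℤ) ^ suc b) (sym (ℤP.pos-* (suc b) (b !))) ⟩
  + (suc b !) * (- 1ℤ) ^ suc b     ∎
  where
  ring : ∀ F s B → F * s * (- 1ℤ - B) ≡ (1ℤ + B) * F * (- 1ℤ * s)
  ring = solve-∀

falling-binomPred : ∀ a b → falling (+ a - 1ℤ) b ≡ + (b !) * binomPred a b
falling-binomPred zero    b       = falling-−1 b
falling-binomPred (suc a) zero    = refl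
falling-binomPred (suc a) (suc b) = begin
  falling (+ suc a - 1ℤ) (suc b)
    ≡⟨ cong (λ x → falling x (suc b)) (ring₁ (+ a)) ⟩
  falling (+ a - 1ℤ + 1ℤ) (suc b)
    ≡⟨ falling-+1 (+ a - 1ℤ) b ⟩
  falling (+ a - 1ℤ) (suc b) + + suc b * falling (+ a - 1ℤ) b
    ≡⟨ cong₂ (λ u v → u + + suc b * v) (falling-binomPred a (suc b)) (falling-binomPred a b) ⟩
  + (suc b !) * binomPred a (suc b) + + suc b * (+ (b !) * binomPred a b)
    ≡⟨ cong (λ f → f * binomPred a (suc b) + + suc b * (+ (b !) * binomPred a b)) (ℤP.pos-* (suc b) (b !)) ⟩
  + suc b * + (b !) * binomPred a (suc b) + + suc b * (+ (b !) * binomPred a b)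
    ≡⟨ ring₂ (+ suc b) (+ (b !)) (binomPred a (suc b)) (binomPred a b) ⟩
  + suc b * + (b !) * binomPred (suc a) (suc b)
    ≡⟨ cong (_* binomPred (suc a) (suc b)) (sym (ℤP.pos-* (suc b) (b !))) ⟩
  + (suc b !) * binomPred (suc a) (suc b) ∎
  where
  ring₁ : ∀ A → 1ℤ + A - 1ℤ ≡ A - 1ℤ + 1ℤ
  ring₁ = solve-∀
  ring₂ : ∀ m f x y → m * f * x + m * (f * y) ≡ m * f * (x + y)
  ring₂ = solve-∀

gbinom-binomPred : ∀ a b → gbinom (+ a - 1ℤ) (+ b) ≡ binomPred a b
gbinom-binomPred a b = begin
  _/ℕ_ (falling (+ a - 1ℤ) b) (b !) {{b ℕP.!≢0}}
    ≡⟨ cong (λ f → _/ℕ_ f (b !) {{b ℕP.!≢0}}) (trans (falling-binomPred a b) (ℤP.*-comm (+ (b !)) _)) ⟩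
  _/ℕ_ (binomPred a b * + (b !)) (b !) {{b ℕP.!≢0}}
    ≡⟨ [i*n]/ℕn≡i (binomPred a b) (b !) {{b ℕP.!≢0}} ⟩
  binomPred a b ∎

-- signedBinom a e = (−1)^e binom (a − 1) e is the coefficient of x^e in (1 − x)^(a − 1).
signedBinom : ℕ → ℤ → ℤ
signedBinom a e = negOnePow e * gbinom (+ a - 1ℤ) e

signedBinom-negative : ∀ a e → ℤ.sign e ≡ Sign.- → signedBinom a e ≡ 0ℤ
signedBinom-negative a -[1+ m ] _ = ℤP.*-zeroʳ (negOnePow -[1+ m ])

signedBinom-nonneg : ∀ a b → signedBinom a (+ b) ≡ (- 1ℤ) ^ b * binomPred a b
signedBinom-nonneg a b = cong ((- 1ℤ) ^ b *_) (gbinom-binomPred a b)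

[−1]^n*[−1]^n≡1 : ∀ n → (- 1ℤ) ^ n * (- 1ℤ) ^ n ≡ 1ℤ
[−1]^n*[−1]^n≡1 zero    = refl
[−1]^n*[−1]^n≡1 (suc n) = trans (ring ((- 1ℤ) ^ n)) ([−1]^n*[−1]^n≡1 n)
  where
  ring : ∀ s → - 1ℤ * s * (- 1ℤ * s) ≡ s * s
  ring = solve-∀

signedBinom-zero : ∀ b → signedBinom 0 (+ b) ≡ 1ℤ
signedBinom-zero b = trans (signedBinom-nonneg 0 b) ([−1]^n*[−1]^n≡1 b)

-- Pascal's rule, i.e. (1 − x)^a = (1 − x) (1 − x)^(a − 1) on coefficients.
signedBinom-suc : ∀ a e → signedBinom (suc a) e ≡ signedBinom a e - signedBinom a (e - 1ℤ)
signedBinom-suc a -[1+ m ] = begin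
  signedBinom (suc a) -[1+ m ]  ≡⟨ signedBinom-negative (suc a) -[1+ m ] refl ⟩
  0ℤ - 0ℤ                       ≡⟨ sym (cong₂ _-_ (signedBinom-negative a -[1+ m ] refl)
                                                   (signedBinom-negative a (-[1+ m ] - 1ℤ) refl)) ⟩
  signedBinom a -[1+ m ] - signedBinom a (-[1+ m ] - 1ℤ) ∎
signedBinom-suc a (+ zero) = begin
  signedBinom (suc a) (+ 0)   ≡⟨ signedBinom-nonneg (suc a) 0 ⟩
  1ℤ - 0ℤ                     ≡⟨ cong₂ _-_ (sym (trans (signedBinom-nonneg a 0) (binomPred-zero a)))
                                           (sym (signedBinom-negative a (+ 0 - 1ℤ) refl)) ⟩
  signedBinom a (+ 0) - signedBinom a (+ 0 - 1ℤ) ∎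
  where
  binomPred-zero : ∀ a → 1ℤ * binomPred a 0 ≡ 1ℤ
  binomPred-zero zero    = refl
  binomPred-zero (suc a) = refl
signedBinom-suc a (+ suc b) = begin
  signedBinom (suc a) (+ suc b)
    ≡⟨ signedBinom-nonneg (suc a) (suc b) ⟩
  - 1ℤ * (- 1ℤ) ^ b * (binomPred a (suc b) + binomPred a b)
    ≡⟨ ring ((- 1ℤ) ^ b) (binomPred a (suc b)) (binomPred a b) ⟩
  - 1ℤ * (- 1ℤ) ^ b * binomPred a (suc b) - (- 1ℤ) ^ b * binomPred a b
    ≡⟨ sym (cong₂ _-_ (signedBinom-nonneg a (suc b)) (signedBinom-nonneg a b)) ⟩
  signedBinom a (+ suc b) - signedBinom a (+ suc b - 1ℤ) ∎
  where
  ring : ∀ s x y → - 1ℤ * s * (x + y) ≡ - 1ℤ * s * x - s * y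
  ring = solve-∀

-- Coefficient sequences of formal Laurent series, indexed by the exponent.

Series : Set
Series = ℤ → ℤ

Poly : Set
Poly = ℤ × ℤ × ℤ

-- Multiplication by p₀ + p₁ x + p₂ x².
act : Poly → Series → Series
act (p₀ , p₁ , p₂) F D = p₀ * F D + p₁ * F (D - 1ℤ) + p₂ * F (D - 1ℤ - 1ℤ)

infixl 6 _+ₚ_
infixl 7 _·ₚ_

_+ₚ_ : Poly → Poly → Poly
(p₀ , p₁ , p₂) +ₚ (q₀ , q₁ , q₂) = p₀ + q₀ , p₁ + q₁ , p₂ + q₂

_·ₚ_ : ℤ → Poly → Poly
c ·ₚ (p₀ , p₁ , p₂) = c * p₀ , c * p₁ , c * p₂

act-+ₚ : ∀ p q F D → act p F D + act q F D ≡ act (p +ₚ q) F D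
act-+ₚ (p₀ , p₁ , p₂) (q₀ , q₁ , q₂) F D = ring p₀ p₁ p₂ q₀ q₁ q₂ (F D) (F (D - 1ℤ)) (F (D - 1ℤ - 1ℤ))
  where
  ring : ∀ p₀ p₁ p₂ q₀ q₁ q₂ x y z →
         p₀ * x + p₁ * y + p₂ * z + (q₀ * x + q₁ * y + q₂ * z) ≡ (p₀ + q₀) * x + (p₁ + q₁) * y + (p₂ + q₂) * z
  ring = solve-∀

act-·ₚ : ∀ c w p F D → c * w * act p F D ≡ act (c ·ₚ p) (λ D → w * F D) D
act-·ₚ c w (p₀ , p₁ , p₂) F D = ring c w p₀ p₁ p₂ (F D) (F (D - 1ℤ)) (F (D - 1ℤ - 1ℤ))
  where
  ring : ∀ c w p₀ p₁ p₂ x y z →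
         c * w * (p₀ * x + p₁ * y + p₂ * z) ≡ c * p₀ * (w * x) + c * p₁ * (w * y) + c * p₂ * (w * z)
  ring = solve-∀

-- (1 − x)^b x^u
factor : Bool → Bool → Poly
factor false false = 1ℤ , 0ℤ , 0ℤ
factor false true  = 0ℤ , 1ℤ , 0ℤ
factor true  false = 1ℤ , - 1ℤ , 0ℤ
factor true  true  = 0ℤ , 1ℤ , - 1ℤ

-- The series is a polynomial of degree < k plus v / (1 − x).
EventuallyEq : Series → ℕ → ℤ → Set
EventuallyEq F k v = ∀ D → + k ℤ.≤ D → F D ≡ v

EventuallyEq-pointwise : ∀ {F G k v} → (∀ D → F D ≡ G D) → EventuallyEq G k v → EventuallyEq F k v
EventuallyEq-pointwise F≗G G≈v D k≤D = trans (F≗G D) (G≈v D k≤D)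

EventuallyEq-1 : ∀ {F k v} → EventuallyEq F k v → EventuallyEq (act (factor false false) F) k v
EventuallyEq-1 {F} {v = v} F≈v D k≤D = begin
  1ℤ * F D + 0ℤ + 0ℤ  ≡⟨ cong (λ x → 1ℤ * x + 0ℤ + 0ℤ) (F≈v D k≤D) ⟩
  1ℤ * v + 0ℤ + 0ℤ    ≡⟨ ring v ⟩
  v                   ∎
  where
  ring : ∀ v → 1ℤ * v + 0ℤ + 0ℤ ≡ v
  ring = solve-∀

EventuallyEq-x : ∀ {F k v} → EventuallyEq F k v → EventuallyEq (act (factor false true) F) (suc k) v
EventuallyEq-x {F} {k} {v} F≈v D 1+k≤D = begin
  0ℤ + 1ℤ * F (D - 1ℤ) + 0ℤ  ≡⟨ cong (λ x → 0ℤ + 1ℤ * x + 0ℤ) (F≈v (D - 1ℤ) (ℤP.+-monoˡ-≤ (- 1ℤ) 1+k≤D)) ⟩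
  0ℤ + 1ℤ * v + 0ℤ           ≡⟨ ring v ⟩
  v                          ∎
  where
  ring : ∀ v → 0ℤ + 1ℤ * v + 0ℤ ≡ v
  ring = solve-∀

EventuallyEq-1-x : ∀ {F k v} → EventuallyEq F k v → EventuallyEq (act (factor true false) F) (suc k) 0ℤ
EventuallyEq-1-x {F} {k} {v} F≈v D 1+k≤D = begin
  1ℤ * F D + - 1ℤ * F (D - 1ℤ) + 0ℤ
    ≡⟨ cong₂ (λ x y → 1ℤ * x + - 1ℤ * y + 0ℤ)
             (F≈v D (ℤP.≤-trans (ℤ.+≤+ (ℕP.n≤1+n k)) 1+k≤D)) (F≈v (D - 1ℤ) (ℤP.+-monoˡ-≤ (- 1ℤ) 1+k≤D)) ⟩
  1ℤ * v + - 1ℤ * v + 0ℤ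
    ≡⟨ ring v ⟩
  0ℤ ∎
  where
  ring : ∀ v → 1ℤ * v + - 1ℤ * v + 0ℤ ≡ 0ℤ
  ring = solve-∀

𝟙 : Bool → ℤ
𝟙 b = if b then 1ℤ else 0ℤ

bit : Bool → ℕ
bit b = if b then 1 else 0

𝟙-∧ : ∀ x y → 𝟙 (x ∧ y) ≡ 𝟙 x * 𝟙 y
𝟙-∧ false y = refl
𝟙-∧ true  y = sym (ℤP.*-identityˡ (𝟙 y))

weight : Bool → ℕ → Bool → ℤ
weight z σ c = 𝟙 z * negOnePow (+ σ) * 𝟙 c

weight-∧ : ∀ z₀ σ₀ c₀ z σ c → weight (z₀ ∧ z) (σ₀ ℕ.+ σ) (c₀ ∧ c) ≡ weight z₀ σ₀ c₀ * weight z σ c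
weight-∧ z₀ σ₀ c₀ z σ c = begin
  𝟙 (z₀ ∧ z) * (- 1ℤ) ^ (σ₀ ℕ.+ σ) * 𝟙 (c₀ ∧ c)
    ≡⟨ cong₂ (λ x y → x * (- 1ℤ) ^ (σ₀ ℕ.+ σ) * y) (𝟙-∧ z₀ z) (𝟙-∧ c₀ c) ⟩
  𝟙 z₀ * 𝟙 z * (- 1ℤ) ^ (σ₀ ℕ.+ σ) * (𝟙 c₀ * 𝟙 c)
    ≡⟨ cong (λ s → 𝟙 z₀ * 𝟙 z * s * (𝟙 c₀ * 𝟙 c)) (ℤP.^-distribˡ-+-* (- 1ℤ) σ₀ σ) ⟩
  𝟙 z₀ * 𝟙 z * ((- 1ℤ) ^ σ₀ * (- 1ℤ) ^ σ) * (𝟙 c₀ * 𝟙 c)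
    ≡⟨ ring (𝟙 z₀) (𝟙 z) ((- 1ℤ) ^ σ₀) ((- 1ℤ) ^ σ) (𝟙 c₀) (𝟙 c) ⟩
  weight z₀ σ₀ c₀ * weight z σ c ∎
  where
  ring : ∀ z₀ z s₀ s c₀ c → z₀ * z * (s₀ * s) * (c₀ * c) ≡ z₀ * s₀ * c₀ * (z * s * c)
  ring = solve-∀

-- A summand of the matrix products: the weight times the coefficient of x^D in x^u (1 − x)^(a − 1).
term : Bool → ℕ → Bool → ℕ → ℕ → Series
term z σ c a u D = weight z σ c * signedBinom a (D - + u)

signedBinom-∷ : ∀ b v a u D →
  signedBinom (bit b ℕ.+ a) (D - + (bit v ℕ.+ u)) ≡ act (factor b v) (λ D → signedBinom a (D - + u)) D
signedBinom-∷ false false a u D = ring (signedBinom a (D - + u))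
  where
  ring : ∀ x → x ≡ 1ℤ * x + 0ℤ + 0ℤ
  ring = solve-∀
signedBinom-∷ false true a u D = begin
  signedBinom a (D - (1ℤ + + u))    ≡⟨ cong (signedBinom a) (shift₁ D (+ u)) ⟩
  signedBinom a (D - 1ℤ - + u)      ≡⟨ ring (signedBinom a (D - 1ℤ - + u)) ⟩
  0ℤ + 1ℤ * signedBinom a (D - 1ℤ - + u) + 0ℤ ∎
  where
  shift₁ : ∀ D x → D - (1ℤ + x) ≡ D - 1ℤ - x
  shift₁ = solve-∀
  ring : ∀ y → y ≡ 0ℤ + 1ℤ * y + 0ℤ
  ring = solve-∀
signedBinom-∷ true false a u D = begin
  signedBinom (suc a) (D - + u)
    ≡⟨ signedBinom-suc a (D - + u) ⟩
  signedBinom a (D - + u) - signedBinom a (D - + u - 1ℤ)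
    ≡⟨ cong (λ e → signedBinom a (D - + u) - signedBinom a e) (swap D (+ u)) ⟩
  signedBinom a (D - + u) - signedBinom a (D - 1ℤ - + u)
    ≡⟨ ring (signedBinom a (D - + u)) (signedBinom a (D - 1ℤ - + u)) ⟩
  1ℤ * signedBinom a (D - + u) + - 1ℤ * signedBinom a (D - 1ℤ - + u) + 0ℤ ∎
  where
  swap : ∀ D x → D - x - 1ℤ ≡ D - 1ℤ - x
  swap = solve-∀
  ring : ∀ x y → x - y ≡ 1ℤ * x + - 1ℤ * y + 0ℤ
  ring = solve-∀
signedBinom-∷ true true a u D = begin
  signedBinom (suc a) (D - (1ℤ + + u))
    ≡⟨ signedBinom-suc a (D - (1ℤ + + u)) ⟩
  signedBinom a (D - (1ℤ + + u)) - signedBinom a (D - (1ℤ + + u) - 1ℤ)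
    ≡⟨ cong₂ (λ e e′ → signedBinom a e - signedBinom a e′) (shift₁ D (+ u)) (shift₂ D (+ u)) ⟩
  signedBinom a (D - 1ℤ - + u) - signedBinom a (D - 1ℤ - 1ℤ - + u)
    ≡⟨ ring (signedBinom a (D - 1ℤ - + u)) (signedBinom a (D - 1ℤ - 1ℤ - + u)) ⟩
  0ℤ + 1ℤ * signedBinom a (D - 1ℤ - + u) + - 1ℤ * signedBinom a (D - 1ℤ - 1ℤ - + u) ∎
  where
  shift₁ : ∀ D x → D - (1ℤ + x) ≡ D - 1ℤ - x
  shift₁ = solve-∀
  shift₂ : ∀ D x → D - (1ℤ + x) - 1ℤ ≡ D - 1ℤ - 1ℤ - x
  shift₂ = solve-∀
  ring : ∀ y z → y - z ≡ 0ℤ + 1ℤ * y + - 1ℤ * z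
  ring = solve-∀

term-∷ : ∀ z₀ σ₀ c₀ b v z σ c a u D →
  term (z₀ ∧ z) (σ₀ ℕ.+ σ) (c₀ ∧ c) (bit b ℕ.+ a) (bit v ℕ.+ u) D
    ≡ act (weight z₀ σ₀ c₀ ·ₚ factor b v) (term z σ c a u) D
term-∷ z₀ σ₀ c₀ b v z σ c a u D = begin
  weight (z₀ ∧ z) (σ₀ ℕ.+ σ) (c₀ ∧ c) * signedBinom (bit b ℕ.+ a) (D - + (bit v ℕ.+ u))
    ≡⟨ cong₂ _*_ (weight-∧ z₀ σ₀ c₀ z σ c) (signedBinom-∷ b v a u D) ⟩
  weight z₀ σ₀ c₀ * weight z σ c * act (factor b v) (λ D → signedBinom a (D - + u)) D
    ≡⟨ act-·ₚ (weight z₀ σ₀ c₀) (weight z σ c) (factor b v) (λ D → signedBinom a (D - + u)) D ⟩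
  act (weight z₀ σ₀ c₀ ·ₚ factor b v) (term z σ c a u) D ∎

term-vanishes : ∀ z σ c a {d u} → d < u → term z σ c a u (+ d) ≡ 0ℤ
term-vanishes z σ c a {d} {u} d<u = begin
  weight z σ c * signedBinom a (+ d - + u)  ≡⟨ cong (weight z σ c *_) (signedBinom-negative a (+ d - + u) negative) ⟩
  weight z σ c * 0ℤ                          ≡⟨ ℤP.*-zeroʳ (weight z σ c) ⟩
  0ℤ                                         ∎
  where
  negative : ℤ.sign (+ d - + u) ≡ Sign.-
  negative = trans (cong ℤ.sign (ℤP.m-n≡m⊖n d u)) (ℤP.sign-⊖-< d<u)

entry≡term : ∀ z σ c a e → 𝟙 z * (negOnePow (+ σ) * (if c then signedBinom a e else 0ℤ)) ≡ weight z σ c * signedBinom a e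
entry≡term z σ true  a e = ring (𝟙 z) (negOnePow (+ σ)) (signedBinom a e)
  where
  ring : ∀ z s x → z * (s * x) ≡ z * s * 1ℤ * x
  ring = solve-∀
entry≡term z σ false a e = ring (𝟙 z) (negOnePow (+ σ)) (signedBinom a e)
  where
  ring : ∀ z s x → z * (s * 0ℤ) ≡ z * s * 0ℤ * x
  ring = solve-∀

sumZ-++ : ∀ xs ys → sumZ (xs ++ ys) ≡ sumZ xs + sumZ ys
sumZ-++ []       ys = sym (ℤP.+-identityˡ (sumZ ys))
sumZ-++ (x ∷ xs) ys = trans (cong (_+_ x) (sumZ-++ xs ys)) (sym (ℤP.+-assoc x (sumZ xs) (sumZ ys)))

sumZ-map-cong : ∀ {A : Set} {f g : A → ℤ} → (∀ x → f x ≡ g x) → ∀ xs → sumZ (map f xs) ≡ sumZ (map g xs)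
sumZ-map-cong f≗g []       = refl
sumZ-map-cong f≗g (x ∷ xs) = cong₂ _+_ (f≗g x) (sumZ-map-cong f≗g xs)

sumZ-filter : ∀ {A : Set} {ℓ} {P : Pred A ℓ} (P? : Decidable P) (f : A → ℤ) →
  (∀ x → ¬ P x → f x ≡ 0ℤ) → ∀ xs → sumZ (map f (filter P? xs)) ≡ sumZ (map f xs)
sumZ-filter P? f f≡0 [] = refl
sumZ-filter P? f f≡0 (x ∷ xs) with P? x
... | yes _  = cong (_+_ (f x)) (sumZ-filter P? f f≡0 xs)
... | no ¬Px = begin
  sumZ (map f (filter P? xs))  ≡⟨ sumZ-filter P? f f≡0 xs ⟩
  sumZ (map f xs)              ≡⟨ ℤP.+-identityˡ (sumZ (map f xs)) ⟨
  0ℤ + sumZ (map f xs)         ≡⟨ cong (_+ sumZ (map f xs)) (f≡0 x ¬Px) ⟨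
  f x + sumZ (map f xs)        ∎

sumZ-act : ∀ {A : Set} p (G : A → Series) xs D →
  sumZ (map (λ x → act p (G x) D) xs) ≡ act p (λ D → sumZ (map (λ x → G x D) xs)) D
sumZ-act (p₀ , p₁ , p₂) G [] D = ring p₀ p₁ p₂
  where
  ring : ∀ p₀ p₁ p₂ → 0ℤ ≡ p₀ * 0ℤ + p₁ * 0ℤ + p₂ * 0ℤ
  ring = solve-∀
sumZ-act p@(p₀ , p₁ , p₂) G (x ∷ xs) D = begin
  act p (G x) D + sumZ (map (λ x → act p (G x) D) xs)
    ≡⟨ cong (_+_ (act p (G x) D)) (sumZ-act p G xs D) ⟩
  act p (G x) D + act p Σ D
    ≡⟨ ring p₀ p₁ p₂ (G x D) (G x (D - 1ℤ)) (G x (D - 1ℤ - 1ℤ)) (Σ D) (Σ (D - 1ℤ)) (Σ (D - 1ℤ - 1ℤ)) ⟩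
  act p (λ D → G x D + Σ D) D ∎
  where
  Σ : Series
  Σ D = sumZ (map (λ x → G x D) xs)
  ring : ∀ p₀ p₁ p₂ x y z x′ y′ z′ →
         p₀ * x + p₁ * y + p₂ * z + (p₀ * x′ + p₁ * y′ + p₂ * z′)
           ≡ p₀ * (x + x′) + p₁ * (y + y′) + p₂ * (z + z′)
  ring = solve-∀

sumSubsets : ∀ {n} → (Subset n → Series) → Series
sumSubsets {n} f D = sumZ (map (λ K → f K D) (allSubsets n))

sumSubsets-∷ : ∀ {n} (f : Subset (suc n) → Series) (g : Subset n → Series) (P : Bool → Poly) →
  (∀ k K D → f (k ∷ K) D ≡ act (P k) (g K) D) →
  ∀ D → sumSubsets f D ≡ act (P true +ₚ P false) (sumSubsets g) D
sumSubsets-∷ {n} f g P f≡Pg D = begin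
  sumZ (map φ (map (true ∷_) A ++ map (false ∷_) A))
    ≡⟨ cong sumZ (List.map-++ φ (map (true ∷_) A) (map (false ∷_) A)) ⟩
  sumZ (map φ (map (true ∷_) A) ++ map φ (map (false ∷_) A))
    ≡⟨ sumZ-++ (map φ (map (true ∷_) A)) (map φ (map (false ∷_) A)) ⟩
  sumZ (map φ (map (true ∷_) A)) + sumZ (map φ (map (false ∷_) A))
    ≡⟨ cong₂ _+_ (half true) (half false) ⟩
  act (P true) (sumSubsets g) D + act (P false) (sumSubsets g) D
    ≡⟨ act-+ₚ (P true) (P false) (sumSubsets g) D ⟩
  act (P true +ₚ P false) (sumSubsets g) D ∎
  where
  A : List (Subset n)
  A = allSubsets n
  φ : Subset (suc n) → ℤ
  φ K = f K D
  half : ∀ k → sumZ (map φ (map (k ∷_) A)) ≡ act (P k) (sumSubsets g) D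
  half k = begin
    sumZ (map φ (map (k ∷_) A))                 ≡⟨ cong sumZ (List.map-∘ A) ⟨
    sumZ (map (λ K → f (k ∷ K) D) A)            ≡⟨ sumZ-map-cong (λ K → f≡Pg k K D) A ⟩
    sumZ (map (λ K → act (P k) (g K) D) A)      ≡⟨ sumZ-act (P k) g A D ⟩
    act (P k) (sumSubsets g) D                  ∎

count-∷ : ∀ {n} x (p : Subset n) → ∣ x ∷ p ∣ ≡ bit x ℕ.+ ∣ p ∣
count-∷ false p = refl
count-∷ true  p = refl

count-∷-+ : ∀ {n} x (p : Subset n) y (q : Subset n) → ∣ x ∷ p ∣ ℕ.+ ∣ y ∷ q ∣ ≡ (bit x ℕ.+ bit y) ℕ.+ (∣ p ∣ ℕ.+ ∣ q ∣)
count-∷-+ x p y q = trans (cong₂ ℕ._+_ (count-∷ x p) (count-∷ y q)) (+-interchange (bit x) (∣ p ∣) (bit y) (∣ q ∣))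

⊆?-∷ : ∀ {n} x (p : Subset n) y q → does ((x ∷ p) ⊆? (y ∷ q)) ≡ (not x ∨ y) ∧ does (p ⊆? q)
⊆?-∷ false p y     q = refl
⊆?-∷ true  p false q = refl
⊆?-∷ true  p true  q = refl

─-∷ : ∀ {n} x (p : Subset n) y q → (x ∷ p) ─ (y ∷ q) ≡ (x ∧ not y) ∷ (p ─ q)
─-∷ false p false q = refl
─-∷ false p true  q = refl
─-∷ true  p false q = refl
─-∷ true  p true  q = refl

term-cong : ∀ {z z′ σ σ′ c c′ a a′ u u′} → z ≡ z′ → σ ≡ σ′ → c ≡ c′ → a ≡ a′ → u ≡ u′ →
  ∀ D → term z σ c a u D ≡ term z′ σ′ c′ a′ u′ D
term-cong refl refl refl refl refl D = refl

-- [Z]_{I,K} [W]_{K,J}, with the degree d replaced by the series index.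
zwTerm : ∀ {n} (S I J K : Subset n) → Series
zwTerm S I J K =
  term (does (I ⊆? (K ⊕ S))) (∣ J ∩ S ∣ ℕ.+ ∣ J ─ K ∣) (does ((K ─ S) ⊆? J)) ∣ S ─ (K ∪ J) ∣ ∣ K ∪ J ∣

zwFactor : (i j s k : Bool) → Poly
zwFactor i j s k =
  weight (not i ∨ (k xor s)) (bit (j ∧ s) ℕ.+ bit (j ∧ not k)) (not (k ∧ not s) ∨ j) ·ₚ factor (s ∧ not (k ∨ j)) (k ∨ j)

zwTerm-∷ : ∀ {n} s (S : Subset n) i I j J k K D →
  zwTerm (s ∷ S) (i ∷ I) (j ∷ J) (k ∷ K) D ≡ act (zwFactor i j s k) (zwTerm S I J K) D
zwTerm-∷ s S i I j J k K D = trans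
  (term-cong (⊆?-∷ i I (k xor s) (K ⊕ S))
             (trans (cong (λ t → ∣ (j ∧ s) ∷ (J ∩ S) ∣ ℕ.+ ∣ t ∣) (─-∷ j J k K)) (count-∷-+ (j ∧ s) (J ∩ S) (j ∧ not k) (J ─ K)))
             (trans (cong (λ t → does (t ⊆? (j ∷ J))) (─-∷ k K s S)) (⊆?-∷ (k ∧ not s) (K ─ S) j J))
             (trans (cong ∣_∣ (─-∷ s S (k ∨ j) (K ∪ J))) (count-∷ (s ∧ not (k ∨ j)) (S ─ (K ∪ J))))
             (count-∷ (k ∨ j) (K ∪ J)) D)
  (term-∷ (not i ∨ (k xor s)) (bit (j ∧ s) ℕ.+ bit (j ∧ not k)) (not (k ∧ not s) ∨ j) (s ∧ not (k ∨ j)) (k ∨ j) _ _ _ _ _ D)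

-- [W]_{I,K} [Z]_{K,J}, with the degree d replaced by the series index.
wzTerm : ∀ {n} (S I J K : Subset n) → Series
wzTerm S I J K =
  term (does (K ⊆? (J ⊕ S))) (∣ K ∩ S ∣ ℕ.+ ∣ K ─ I ∣) (does ((I ─ S) ⊆? K)) ∣ S ─ (I ∪ K) ∣ ∣ I ∪ K ∣

wzFactor : (i j s k : Bool) → Poly
wzFactor i j s k =
  weight (not k ∨ (j xor s)) (bit (k ∧ s) ℕ.+ bit (k ∧ not i)) (not (i ∧ not s) ∨ k) ·ₚ factor (s ∧ not (i ∨ k)) (i ∨ k)

wzTerm-∷ : ∀ {n} s (S : Subset n) i I j J k K D →
  wzTerm (s ∷ S) (i ∷ I) (j ∷ J) (k ∷ K) D ≡ act (wzFactor i j s k) (wzTerm S I J K) D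
wzTerm-∷ s S i I j J k K D = trans
  (term-cong (⊆?-∷ k K (j xor s) (J ⊕ S))
             (trans (cong (λ t → ∣ (k ∧ s) ∷ (K ∩ S) ∣ ℕ.+ ∣ t ∣) (─-∷ k K i I)) (count-∷-+ (k ∧ s) (K ∩ S) (k ∧ not i) (K ─ I)))
             (trans (cong (λ t → does (t ⊆? (k ∷ K))) (─-∷ i I s S)) (⊆?-∷ (i ∧ not s) (I ─ S) k K))
             (trans (cong ∣_∣ (─-∷ s S (i ∨ k) (I ∪ K))) (count-∷ (s ∧ not (i ∨ k)) (S ─ (I ∪ K))))
             (count-∷ (i ∨ k) (I ∪ K)) D)
  (term-∷ (not k ∨ (j xor s)) (bit (k ∧ s) ℕ.+ bit (k ∧ not i)) (not (i ∧ not s) ∨ k) (s ∧ not (i ∨ k)) (i ∨ k) _ _ _ _ _ D)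

-- Over the empty ground set the sum is the series 1 / (1 − x).
term-base-EventuallyEq : EventuallyEq (sumSubsets {0} (λ _ → term true 0 true 0 0)) 0 1ℤ
term-base-EventuallyEq (+ b) _ = begin
  1ℤ * signedBinom 0 (+ b - + 0) + 0ℤ  ≡⟨ ℤP.+-identityʳ _ ⟩
  1ℤ * signedBinom 0 (+ b - + 0)       ≡⟨ ℤP.*-identityˡ _ ⟩
  signedBinom 0 (+ b - + 0)            ≡⟨ cong (signedBinom 0) (ℤP.+-identityʳ (+ b)) ⟩
  signedBinom 0 (+ b)                  ≡⟨ signedBinom-zero b ⟩
  1ℤ                                   ∎

idMat-false-true : ∀ {n} (I J : Subset n) → idMat (false ∷ I) (true ∷ J) ≡ 0ℤ
idMat-false-true I J with I ⊆? J
... | yes _ = refl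
... | no  _ = refl

zwSum-EventuallyEq : ∀ {n} (S I J : Subset n) → EventuallyEq (sumSubsets (zwTerm S I J)) ∣ I ∣ (idMat I J)
zwSum-EventuallyEq [] [] [] = term-base-EventuallyEq
zwSum-EventuallyEq (s ∷ S) (i ∷ I) (j ∷ J) =
  EventuallyEq-pointwise (sumSubsets-∷ _ (zwTerm S I J) (zwFactor i j s) (zwTerm-∷ s S i I j J)) (step i j s)
  where
  F = sumSubsets (zwTerm S I J)
  ih : EventuallyEq F ∣ I ∣ (idMat I J)
  ih = zwSum-EventuallyEq S I J
  -- For concrete bits the combined factor computes to 1, 0, x or 1 − x.
  step : ∀ i j s → EventuallyEq (act (zwFactor i j s true +ₚ zwFactor i j s false) F) ∣ i ∷ I ∣ (idMat (i ∷ I) (j ∷ J))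
  step false false false = EventuallyEq-1 ih
  step false false true  = EventuallyEq-1 ih
  step false true  false = λ _ _ → sym (idMat-false-true I J)
  step false true  true  = λ _ _ → sym (idMat-false-true I J)
  step true  false false = λ _ _ → refl
  step true  false true  = EventuallyEq-1-x ih
  step true  true  false = EventuallyEq-x ih
  step true  true  true  = EventuallyEq-x ih

wzSum-EventuallyEq : ∀ {n} (S I J : Subset n) → EventuallyEq (sumSubsets (wzTerm S I J)) ∣ J ∣ (idMat I J)
wzSum-EventuallyEq [] [] [] = term-base-EventuallyEq
wzSum-EventuallyEq (s ∷ S) (i ∷ I) (j ∷ J) =
  EventuallyEq-pointwise (sumSubsets-∷ _ (wzTerm S I J) (wzFactor i j s) (wzTerm-∷ s S i I j J)) (step i j s)
  where
  F = sumSubsets (wzTerm S I J)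
  ih : EventuallyEq F ∣ J ∣ (idMat I J)
  ih = wzSum-EventuallyEq S I J
  step : ∀ i j s → EventuallyEq (act (wzFactor i j s true +ₚ wzFactor i j s false) F) ∣ j ∷ J ∣ (idMat (i ∷ I) (j ∷ J))
  step false false false = EventuallyEq-1 ih
  step false false true  = EventuallyEq-1 ih
  step false true  false = subst (EventuallyEq _ _) (sym (idMat-false-true I J)) (EventuallyEq-1-x ih)
  step false true  true  = subst (EventuallyEq _ _) (sym (idMat-false-true I J)) (EventuallyEq-1-x ih)
  step true  false false = λ _ _ → refl
  step true  false true  = λ _ _ → refl
  step true  true  false = EventuallyEq-x ih
  step true  true  true  = EventuallyEq-x ih

ZW≡id : ∀ n d (S I J : Subset n) → ∣ I ∣ ≤ d → mulPd d (Zmat S) (Wmat d S) I J ≡ idMat I J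
ZW≡id n d S I J ∣I∣≤d = begin
  sumZ (map (λ K → Zmat S I K * Wmat d S K J) (Pd d n))
    ≡⟨ sumZ-map-cong (λ K → entry≡term (does (I ⊆? (K ⊕ S))) (∣ J ∩ S ∣ ℕ.+ ∣ J ─ K ∣) (does ((K ─ S) ⊆? J))
                                        ∣ S ─ (K ∪ J) ∣ (+ d - + ∣ K ∪ J ∣)) (Pd d n) ⟩
  sumZ (map (λ K → zwTerm S I J K (+ d)) (Pd d n))
    ≡⟨ sumZ-filter (λ K → ∣ K ∣ ≤? d) (λ K → zwTerm S I J K (+ d)) vanishes (allSubsets n) ⟩
  sumSubsets (zwTerm S I J) (+ d)
    ≡⟨ zwSum-EventuallyEq S I J (+ d) (ℤ.+≤+ ∣I∣≤d) ⟩
  idMat I J ∎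
  where
  vanishes : ∀ K → ¬ ∣ K ∣ ≤ d → zwTerm S I J K (+ d) ≡ 0ℤ
  vanishes K ∣K∣≰d = term-vanishes (does (I ⊆? (K ⊕ S))) (∣ J ∩ S ∣ ℕ.+ ∣ J ─ K ∣) (does ((K ─ S) ⊆? J)) ∣ S ─ (K ∪ J) ∣
    (ℕP.<-≤-trans (ℕP.≰⇒> ∣K∣≰d) (∣p∣≤∣p∪q∣ K J))

WZ≡id : ∀ n d (S I J : Subset n) → ∣ J ∣ ≤ d → mulPd d (Wmat d S) (Zmat S) I J ≡ idMat I J
WZ≡id n d S I J ∣J∣≤d = begin
  sumZ (map (λ K → Wmat d S I K * Zmat S K J) (Pd d n))
    ≡⟨ sumZ-map-cong (λ K → trans (ℤP.*-comm (Wmat d S I K) (Zmat S K J))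
         (entry≡term (does (K ⊆? (J ⊕ S))) (∣ K ∩ S ∣ ℕ.+ ∣ K ─ I ∣) (does ((I ─ S) ⊆? K))
                     ∣ S ─ (I ∪ K) ∣ (+ d - + ∣ I ∪ K ∣))) (Pd d n) ⟩
  sumZ (map (λ K → wzTerm S I J K (+ d)) (Pd d n))
    ≡⟨ sumZ-filter (λ K → ∣ K ∣ ≤? d) (λ K → wzTerm S I J K (+ d)) vanishes (allSubsets n) ⟩
  sumSubsets (wzTerm S I J) (+ d)
    ≡⟨ wzSum-EventuallyEq S I J (+ d) (ℤ.+≤+ ∣J∣≤d) ⟩
  idMat I J ∎
  where
  vanishes : ∀ K → ¬ ∣ K ∣ ≤ d → wzTerm S I J K (+ d) ≡ 0ℤ
  vanishes K ∣K∣≰d = term-vanishes (does (K ⊆? (J ⊕ S))) (∣ K ∩ S ∣ ℕ.+ ∣ K ─ I ∣) (does ((I ─ S) ⊆? K)) ∣ S ─ (I ∪ K) ∣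
    (ℕP.<-≤-trans (ℕP.≰⇒> ∣K∣≰d) (∣q∣≤∣p∪q∣ I K))

lemma3 : (n d : ℕ) (S : Subset n) → (I J : Subset n) → ∣ I ∣ ≤ d → ∣ J ∣ ≤ d →
    (mulPd d (Zmat S) (Wmat d S) I J ≡ idMat I J) × (mulPd d (Wmat d S) (Zmat S) I J ≡ idMat I J)
lemma3 n d S I J ∣I∣≤d ∣J∣≤d = ZW≡id n d S I J ∣I∣≤d , WZ≡id n d S I J ∣J∣≤d
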